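{- Let $r\ge3$ and $1\le k<n$ be integers, let $\mathcal{D}=\{(a,b)\in\mathbb{N}^2: a+b\le k,\ b\le k,\ b\le n-k\}$, and let $p_{ij}(x,y)=(r-1)^jK_i(x,k-j,r-1)\,E_j(y,n-x,k-x)$ (the eigenvalues of the non-binary Johnson scheme $J_r(k,n)$). Then for $(i,j),(x,y)\in\mathcal{D}$ (whenever all denominators are nonzero), $$i\,p_{ij}(x,y)=\mathcal P_1p_{ij}(x+1,y)+\mathcal P_2p_{ij}(x+1,y-1)+\mathcal P_3p_{ij}(x-1,y)+\mathcal P_4p_{ij}(x-1,y+1)+\mathcal P_5p_{ij}(x,y-1)+\mathcal P_6p_{ij}(x,y+1)+\mathcal P_7p_{ij}(x,y),$$ $$j\,p_{ij}(x,y)=B\,p_{ij}(x,y+1)-(B+D)\,p_{ij}(x,y)+D\,p_{ij}(x,y-1),$$ where $B=\frac{(y+x-k)(y+x-n-1)(y+k-n)}{(2y+x-n)(2y+x-n-1)}$, $D=-\frac{y(y+x-k-1)(y+k-n-1)}{(2y+x-n-1)(2y+x-n-2)}$, $\mathcal P_1=-\frac{(r-2)(n-x-y+1)(k-x-y)}{(r-1)(n-x-2y+1)}$, $\mathcal P_2=\frac{y(r-2)(y+k-n-1)}{(r-1)(n-x-2y+1)}$, $\mathcal P_3=-\frac{(k-x+1-y)x}{(r-1)(n-x-2y+1)}$, $\mathcal P_4=\frac{x(y+k-n)}{(r-1)(n-x-2y+1)}$, $\mathcal P_5=-\frac{r-2}{r-1}D$, $\mathcal P_6=-\frac{r-2}{r-1}B$,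 and $\mathcal P_7=-\mathcal P_1-\mathcal P_2-\mathcal P_3-\mathcal P_4-\mathcal P_5-\mathcal P_6$.
   Context: Binomial coefficients are generalized: $\binom{a}{b}=a(a-1)\cdots(a-b+1)/b!$ for integers $b\ge0$, $0$ for $b<0$. Krawtchouk: $K_i(x,N,p)=\sum_{\ell=0}^i(-1)^\ell(p-1)^{i-\ell}\binom{x}{\ell}\binom{N-x}{i-\ell}$. Eberlein: $E_i(x,N,p)=\sum_{\ell=0}^i(-1)^\ell\binom{x}{\ell}\binom{p-x}{i-\ell}\binom{N-p-x}{i-\ell}$. With these definitions $p_{ij}(x,y)$ is a polynomial in $x,y$, so the shifted values $p_{ij}(x\pm1,\cdot)$, $p_{ij}(\cdot,y\pm1)$ are given by the same formula. -}

module Defs where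

open import Data.Nat as ℕ using (ℕ; zero; suc; _≤_; _∸_)
open import Data.Integer using (+_)
open import Data.Rational using (ℚ; _+_; _*_; _-_; -_; _/_; _÷_; 0ℚ; 1ℚ; NonZero)
open import Relation.Binary.PropositionalEquality using (_≢_)

⟦_⟧ : ℕ → ℚ
⟦ n ⟧ = + n / 1

_^ℚ_ : ℚ → ℕ → ℚ
q ^ℚ zero = 1ℚ
q ^ℚ suc m = (q ^ℚ m) * q

sgn : ℕ → ℚ
sgn l = (- 1ℚ) ^ℚ l

sumTo : ℕ → (ℕ → ℚ) → ℚ
sumTo zero f = f 0
sumTo (suc i) f = sumTo i f + f (suc i)

binom : ℚ → ℕ → ℚ
binom a zero = 1ℚ
binom a (suc b) = (binom a b * (a - ⟦ b ⟧)) * (+ 1 / suc b)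

-- binomial with possibly negative lower index (0 for b < 0):
-- we only need  binom a (i - l)  with l ≤ i, so ℕ lower index suffices.

K : ℕ → ℚ → ℚ → ℚ → ℚ
K i x N p = sumTo i (λ l → sgn l * ((p - 1ℚ) ^ℚ (i ∸ l)) * binom x l * binom (N - x) (i ∸ l))

E : ℕ → ℚ → ℚ → ℚ → ℚ
E i x N p = sumTo i (λ l → sgn l * binom x l * binom (p - x) (i ∸ l) * binom (N - p - x) (i ∸ l))

pEig : (r k n i j : ℕ) → ℚ → ℚ → ℚ
pEig r k n i j x y =
  ((⟦ r ⟧ - 1ℚ) ^ℚ j) * K i x (⟦ k ⟧ - ⟦ j ⟧) (⟦ r ⟧ - 1ℚ) * E j y (⟦ n ⟧ - x) (⟦ k ⟧ - x)

InD : (k n a b : ℕ) → Set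
InD k n a b = (a ℕ.+ b ≤ k) Data.Product.× (b ≤ k) Data.Product.× (b ≤ n ∸ k)
  where import Data.Product

div : (p q : ℚ) → q ≢ 0ℚ → ℚ
div p q h = _÷_ p q {{Data.Rational.≢-nonZero h}}
  where import Data.Rational

inv-r-1 : (r : ℕ) → 3 ≤ r → ℚ
inv-r-1 zero ()
inv-r-1 (suc zero) (ℕ.s≤s ())
inv-r-1 (suc (suc zero)) (ℕ.s≤s (ℕ.s≤s ()))
inv-r-1 (suc (suc (suc r'))) _ = + 1 / suc (suc r')

den1 den2 den3 den4 : (n x y : ℕ) → ℚ
den1 n x y = ⟦ 2 ℕ.* y ℕ.+ x ⟧ - ⟦ n ⟧
den2 n x y = ⟦ 2 ℕ.* y ℕ.+ x ⟧ - ⟦ n ⟧ - 1ℚ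
den3 n x y = ⟦ 2 ℕ.* y ℕ.+ x ⟧ - ⟦ n ⟧ - ⟦ 2 ⟧
den4 n x y = ⟦ n ⟧ - ⟦ x ⟧ - ⟦ 2 ℕ.* y ⟧ + 1ℚ

Bco : (k n x y : ℕ) → den1 n x y ≢ 0ℚ → den2 n x y ≢ 0ℚ → ℚ
Bco k n x y h1 h2 =
  div (div ((⟦ y ⟧ + ⟦ x ⟧ - ⟦ k ⟧) * (⟦ y ⟧ + ⟦ x ⟧ - ⟦ n ⟧ - 1ℚ) * (⟦ y ⟧ + ⟦ k ⟧ - ⟦ n ⟧))
           (den1 n x y) h1) (den2 n x y) h2

Dco : (k n x y : ℕ) → den2 n x y ≢ 0ℚ → den3 n x y ≢ 0ℚ → ℚ
Dco k n x y h2 h3 =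
  - div (div (⟦ y ⟧ * (⟦ y ⟧ + ⟦ x ⟧ - ⟦ k ⟧ - 1ℚ) * (⟦ y ⟧ + ⟦ k ⟧ - ⟦ n ⟧ - 1ℚ))
             (den2 n x y) h2) (den3 n x y) h3

-- Both identities are linear combinations of three-term relations. The Eberlein factor
-- E_j(y, n - x, k - x) depends on x only through P = k - x, and satisfies two contiguous relations
-- in (y, P); the Krawtchouk factor satisfies the classical three-term recurrence in x. Each relation
-- is proved termwise: its summand is a discrete divergence along the antidiagonal l + u = j, so the
-- sum telescopes. Eliminating the values at P + 1 from the relations at y and y + 1 gives the
-- recurrence in y; combining the relations at x ± 1 with the Krawtchouk recurrence and the
-- recurrence in y gives the one in x.

module Submission where

open import Defs
open import Data.Nat using (ℕ; _≤_; _<_)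
open import Data.Product using (_×_)
open import Data.Rational using (ℚ; _+_; _*_; _-_; -_; 0ℚ; 1ℚ)
open import Relation.Binary.PropositionalEquality using (_≡_; _≢_)

open import Data.Integer as ℤ using (+_)
import Data.Integer.Properties as ℤ
open import Data.List using (_∷_; [])
open import Data.Maybe.Base as Maybe using ()
open import Data.Nat as ℕ using (zero; suc; _∸_; z≤n; s≤s)
import Data.Nat.Properties as ℕ
open import Data.Nat.Coprimality as Coprime using (1-coprimeTo)
open import Data.Product using (_,_)
open import Data.Rational using (mkℚ; _/_; 1/_; ≢-nonZero)
open import Data.Rational.Properties
  using (+-*-commutativeRing; _≟_; normalize-coprime; *-inverseˡ; *-inverseʳ; *-identityʳ;
         *-assoc; *-zeroˡ; *-zeroʳ; +-identityˡ; 1≢0)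
open import Algebra.Properties.Group Data.Rational.Properties.+-0-group using ()
  renaming (x∙y⁻¹≈ε⇒x≈y to x-y≡0⇒x≡y)
open import Level using (0ℓ)
open import Relation.Binary.PropositionalEquality
  using (refl; sym; trans; cong; cong₂; module ≡-Reasoning)
open import Relation.Nullary.Decidable using (dec⇒maybe)
open import Tactic.RingSolver using (solve-∀; solve)
open import Tactic.RingSolver.Core.AlmostCommutativeRing
  using (AlmostCommutativeRing; fromCommutativeRing)

ℚ-ring : AlmostCommutativeRing 0ℓ 0ℓ
ℚ-ring = fromCommutativeRing +-*-commutativeRing λ q → Maybe.map sym (dec⇒maybe (q ≟ 0ℚ))

⟦⟧-suc : ∀ n → ⟦ suc n ⟧ ≡ ⟦ n ⟧ + 1ℚ
⟦⟧-suc n rewrite normalize-coprime (Coprime.sym (1-coprimeTo n)) =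
  cong (_/ 1) (sym (trans (cong (ℤ._+ + 1) (ℤ.*-identityʳ (+ n))) (cong +_ (ℕ.+-comm n 1))))

⟦⟧-+ : ∀ m n → ⟦ m ℕ.+ n ⟧ ≡ ⟦ m ⟧ + ⟦ n ⟧
⟦⟧-+ zero    n = sym (+-identityˡ ⟦ n ⟧)
⟦⟧-+ (suc m) n = begin
  ⟦ suc (m ℕ.+ n) ⟧     ≡⟨ ⟦⟧-suc (m ℕ.+ n) ⟩
  ⟦ m ℕ.+ n ⟧ + 1ℚ      ≡⟨ cong (_+ 1ℚ) (⟦⟧-+ m n) ⟩
  ⟦ m ⟧ + ⟦ n ⟧ + 1ℚ    ≡⟨ swap ⟦ m ⟧ ⟦ n ⟧ ⟩
  (⟦ m ⟧ + 1ℚ) + ⟦ n ⟧  ≡⟨ cong (_+ ⟦ n ⟧) (⟦⟧-suc m) ⟨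
  ⟦ suc m ⟧ + ⟦ n ⟧     ∎
  where
  open ≡-Reasoning
  swap : ∀ a b → a + b + 1ℚ ≡ (a + 1ℚ) + b
  swap = solve-∀ ℚ-ring

⟦⟧-* : ∀ m n → ⟦ m ℕ.* n ⟧ ≡ ⟦ m ⟧ * ⟦ n ⟧
⟦⟧-* zero    n = sym (*-zeroˡ ⟦ n ⟧)
⟦⟧-* (suc m) n = begin
  ⟦ n ℕ.+ m ℕ.* n ⟧      ≡⟨ ⟦⟧-+ n (m ℕ.* n) ⟩
  ⟦ n ⟧ + ⟦ m ℕ.* n ⟧    ≡⟨ cong (λ c → ⟦ n ⟧ + c) (⟦⟧-* m n) ⟩
  ⟦ n ⟧ + ⟦ m ⟧ * ⟦ n ⟧  ≡⟨ distrib ⟦ m ⟧ ⟦ n ⟧ ⟩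
  (⟦ m ⟧ + 1ℚ) * ⟦ n ⟧   ≡⟨ cong (_* ⟦ n ⟧) (⟦⟧-suc m) ⟨
  ⟦ suc m ⟧ * ⟦ n ⟧      ∎
  where
  open ≡-Reasoning
  distrib : ∀ a b → b + a * b ≡ (a + 1ℚ) * b
  distrib = solve-∀ ℚ-ring

⟦⟧-∸ : ∀ {l j} → l ≤ j → ⟦ j ⟧ ≡ ⟦ l ⟧ + ⟦ j ∸ l ⟧
⟦⟧-∸ {l} {j} l≤j = trans (cong ⟦_⟧ (sym (ℕ.m+[n∸m]≡n l≤j))) (⟦⟧-+ l (j ∸ l))

1/suc*suc : ∀ n → (+ 1 / suc n) * ⟦ suc n ⟧ ≡ 1ℚ
1/suc*suc n rewrite normalize-coprime (Coprime.sym (1-coprimeTo (suc n)))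
                  | normalize-coprime {1} {n} (1-coprimeTo (suc n)) =
  *-inverseˡ (mkℚ (+ suc n) 0 (Coprime.sym (1-coprimeTo (suc n))))

-- Binomial coefficients as falling factorials

falling : ℚ → ℕ → ℚ
falling a zero    = 1ℚ
falling a (suc b) = falling a b * (a - ⟦ b ⟧)

invFactorial : ℕ → ℚ
invFactorial zero    = 1ℚ
invFactorial (suc b) = invFactorial b * (+ 1 / suc b)

binom≡falling : ∀ a b → binom a b ≡ falling a b * invFactorial b
binom≡falling a zero    = refl
binom≡falling a (suc b) =
  trans (cong (λ c → c * (a - ⟦ b ⟧) * (+ 1 / suc b)) (binom≡falling a b))
        (reassoc (falling a b) (invFactorial b) (a - ⟦ b ⟧) (+ 1 / suc b))
  where
  reassoc : ∀ f i d w → f * i * d * w ≡ f * d * (i * w)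
  reassoc = solve-∀ ℚ-ring

invFactorial-pred : ∀ b → invFactorial b ≡ invFactorial (suc b) * (⟦ b ⟧ + 1ℚ)
invFactorial-pred b = begin
  invFactorial b                                 ≡⟨ *-identityʳ (invFactorial b) ⟨
  invFactorial b * 1ℚ                            ≡⟨ cong (invFactorial b *_) (1/suc*suc b) ⟨
  invFactorial b * ((+ 1 / suc b) * ⟦ suc b ⟧)   ≡⟨ *-assoc (invFactorial b) _ _ ⟨
  invFactorial (suc b) * ⟦ suc b ⟧               ≡⟨ cong (invFactorial (suc b) *_) (⟦⟧-suc b) ⟩
  invFactorial (suc b) * (⟦ b ⟧ + 1ℚ)            ∎
  where open ≡-Reasoning

falling-suc-suc : ∀ a b → falling (a + 1ℚ) (suc b) ≡ (a + 1ℚ) * falling a b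
falling-suc-suc a zero    = base a
  where
  base : ∀ a → 1ℚ * (a + 1ℚ - 0ℚ) ≡ (a + 1ℚ) * 1ℚ
  base = solve-∀ ℚ-ring
falling-suc-suc a (suc b) = begin
  falling (a + 1ℚ) (suc b) * (a + 1ℚ - ⟦ suc b ⟧)  ≡⟨ cong₂ (λ f c → f * (a + 1ℚ - c)) (falling-suc-suc a b) (⟦⟧-suc b) ⟩
  (a + 1ℚ) * falling a b * (a + 1ℚ - (⟦ b ⟧ + 1ℚ))  ≡⟨ step a (falling a b) ⟦ b ⟧ ⟩
  (a + 1ℚ) * (falling a b * (a - ⟦ b ⟧))            ∎
  where
  open ≡-Reasoning
  step : ∀ a f c → (a + 1ℚ) * f * (a + 1ℚ - (c + 1ℚ)) ≡ (a + 1ℚ) * (f * (a - c))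
  step = solve-∀ ℚ-ring

-- In a termwise identity every binomial is written as a polynomial times falling a b * invFactorial m
-- for one common pair (a, b), which turns the identity into one the ring solver can check. The upper
-- argument is taken up to propositional equality, as it arises in unnormalised form.

binom-lower : ∀ a b → binom a b ≡ falling a b * (invFactorial (suc b) * (⟦ b ⟧ + 1ℚ))
binom-lower a b = trans (binom≡falling a b) (cong (falling a b *_) (invFactorial-pred b))

binom-suc : ∀ {a′} a b → a′ ≡ a → binom a′ (suc b) ≡ falling a b * (a - ⟦ b ⟧) * invFactorial (suc b)
binom-suc a b refl = binom≡falling a (suc b)

binom-suc-upper : ∀ {a′} a b → a′ ≡ a + 1ℚ → binom a′ (suc b) ≡ a′ * falling a b * invFactorial (suc b)
binom-suc-upper a b refl =
  trans (binom≡falling (a + 1ℚ) (suc b)) (cong (_* invFactorial (suc b)) (falling-suc-suc a b))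

binom-suc-upper-lower : ∀ {a′} a b → a′ ≡ a + 1ℚ →
  binom a′ (suc b) ≡ a′ * falling a b * (invFactorial (suc (suc b)) * (⟦ suc b ⟧ + 1ℚ))
binom-suc-upper-lower a b refl =
  trans (binom≡falling (a + 1ℚ) (suc b)) (cong₂ _*_ (falling-suc-suc a b) (invFactorial-pred (suc b)))

binom-2+ : ∀ {a′} a b → a′ ≡ a →
  binom a′ (suc (suc b)) ≡ falling a b * (a - ⟦ b ⟧) * (a - ⟦ suc b ⟧) * invFactorial (suc (suc b))
binom-2+ a b refl = binom≡falling a (suc (suc b))

binom-2+-upper : ∀ {a′} a b → a′ ≡ a + 1ℚ →
  binom a′ (suc (suc b)) ≡ a′ * falling a b * (a′ - ⟦ suc b ⟧) * invFactorial (suc (suc b))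
binom-2+-upper a b refl =
  trans (binom≡falling (a + 1ℚ) (suc (suc b)))
        (cong (λ f → f * (a + 1ℚ - ⟦ suc b ⟧) * invFactorial (suc (suc b))) (falling-suc-suc a b))

binom-2+-upper² : ∀ {a″} a b → a″ ≡ (a + 1ℚ) + 1ℚ →
  binom a″ (suc (suc b)) ≡ a″ * ((a + 1ℚ) * falling a b) * invFactorial (suc (suc b))
binom-2+-upper² a b refl =
  trans (binom≡falling ((a + 1ℚ) + 1ℚ) (suc (suc b)))
        (cong (_* invFactorial (suc (suc b)))
              (trans (falling-suc-suc (a + 1ℚ) (suc b)) (cong ((a + 1ℚ + 1ℚ) *_) (falling-suc-suc a b))))

binom-1 : ∀ a → binom a 1 ≡ a
binom-1 a = unit a
  where
  unit : ∀ a → 1ℚ * (a - 0ℚ) * 1ℚ ≡ a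
  unit = solve-∀ ℚ-ring

sumTo-cong≤ : ∀ j {F G : ℕ → ℚ} → (∀ l → l ≤ j → F l ≡ G l) → sumTo j F ≡ sumTo j G
sumTo-cong≤ zero    F≗G = F≗G 0 z≤n
sumTo-cong≤ (suc j) F≗G =
  cong₂ _+_ (sumTo-cong≤ j (λ l l≤j → F≗G l (ℕ.m≤n⇒m≤1+n l≤j))) (F≗G (suc j) ℕ.≤-refl)

sumTo-cong : ∀ j {F G : ℕ → ℚ} → (∀ l → F l ≡ G l) → sumTo j F ≡ sumTo j G
sumTo-cong j F≗G = sumTo-cong≤ j (λ l _ → F≗G l)

sumTo-linear₃ : ∀ j a b c (F G H : ℕ → ℚ) →
  a * sumTo j F + b * sumTo j G + c * sumTo j H ≡ sumTo j (λ l → a * F l + b * G l + c * H l)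
sumTo-linear₃ zero    a b c F G H = refl
sumTo-linear₃ (suc j) a b c F G H =
  trans (split a b c (sumTo j F) (sumTo j G) (sumTo j H) (F (suc j)) (G (suc j)) (H (suc j)))
        (cong (_+ (a * F (suc j) + b * G (suc j) + c * H (suc j))) (sumTo-linear₃ j a b c F G H))
  where
  split : ∀ a b c x y z u v w →
    a * (x + u) + b * (y + v) + c * (z + w) ≡ (a * x + b * y + c * z) + (a * u + b * v + c * w)
  split = solve-∀ ℚ-ring

-- f is the discrete divergence of g (with g vanishing off ℕ²), so its antidiagonal sums telescope.
module _ (f g : ℕ → ℕ → ℚ)
         (corner : f 0 0 ≡ 0ℚ)
         (left   : ∀ u → f 0 (suc u) ≡ g 0 u)
         (bottom : ∀ l → f (suc l) 0 ≡ - g l 0)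
         (inner  : ∀ l u → f (suc l) (suc u) ≡ g (suc l) u - g l (suc u)) where

  private
    partial-antidiagonal : ∀ l u → sumTo l (λ t → f t ((l ℕ.+ suc u) ∸ t)) ≡ g l u
    partial-antidiagonal zero    u = left u
    partial-antidiagonal (suc l) u = begin
      sumTo l (λ t → f t ((suc l ℕ.+ suc u) ∸ t)) + f (suc l) ((l ℕ.+ suc u) ∸ l)
        ≡⟨ cong₂ _+_ (sumTo-cong l (λ t → cong (λ s → f t (s ∸ t)) (sym (ℕ.+-suc l (suc u)))))
                     (cong (f (suc l)) (ℕ.m+n∸m≡n l (suc u))) ⟩
      sumTo l (λ t → f t ((l ℕ.+ suc (suc u)) ∸ t)) + f (suc l) (suc u)
        ≡⟨ cong₂ _+_ (partial-antidiagonal l (suc u)) (inner l u) ⟩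
      g l (suc u) + (g (suc l) u - g l (suc u))
        ≡⟨ cancel (g l (suc u)) (g (suc l) u) ⟩
      g (suc l) u ∎
      where
      open ≡-Reasoning
      cancel : ∀ a b → a + (b - a) ≡ b
      cancel = solve-∀ ℚ-ring

  antidiagonal-sum≡0 : ∀ j → sumTo j (λ l → f l (j ∸ l)) ≡ 0ℚ
  antidiagonal-sum≡0 zero    = corner
  antidiagonal-sum≡0 (suc j) = begin
    sumTo j (λ t → f t (suc j ∸ t)) + f (suc j) (j ∸ j)
      ≡⟨ cong₂ _+_ (sumTo-cong j (λ t → cong (λ s → f t (s ∸ t)) (ℕ.+-comm 1 j)))
                   (cong (f (suc j)) (ℕ.n∸n≡0 j)) ⟩
    sumTo j (λ t → f t ((j ℕ.+ 1) ∸ t)) + f (suc j) 0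
      ≡⟨ cong₂ _+_ (partial-antidiagonal j 0) (bottom j) ⟩
    g j 0 + - g j 0
      ≡⟨ cancel (g j 0) ⟩
    0ℚ ∎
    where
    open ≡-Reasoning
    cancel : ∀ a → a + - a ≡ 0ℚ
    cancel = solve-∀ ℚ-ring

antidiagonal-relation : ∀ (a b c : ℚ → ℚ) (F G H g : ℕ → ℕ → ℚ) →
  let f = λ l u → a (⟦ l ⟧ + ⟦ u ⟧) * F l u + b (⟦ l ⟧ + ⟦ u ⟧) * G l u + c (⟦ l ⟧ + ⟦ u ⟧) * H l u in
  f 0 0 ≡ 0ℚ → (∀ u → f 0 (suc u) ≡ g 0 u) → (∀ l → f (suc l) 0 ≡ - g l 0) →
  (∀ l u → f (suc l) (suc u) ≡ g (suc l) u - g l (suc u)) →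
  ∀ j → a ⟦ j ⟧ * sumTo j (λ l → F l (j ∸ l)) + b ⟦ j ⟧ * sumTo j (λ l → G l (j ∸ l))
          + c ⟦ j ⟧ * sumTo j (λ l → H l (j ∸ l)) ≡ 0ℚ
antidiagonal-relation a b c F G H g corner left bottom inner j = begin
  _                                                 ≡⟨ sumTo-linear₃ j (a ⟦ j ⟧) (b ⟦ j ⟧) (c ⟦ j ⟧) _ _ _ ⟩
  sumTo j (λ l → f′ ⟦ j ⟧ l (j ∸ l))                 ≡⟨ sumTo-cong≤ j (λ l l≤j → cong (λ s → f′ s l (j ∸ l)) (⟦⟧-∸ l≤j)) ⟩
  sumTo j (λ l → f′ (⟦ l ⟧ + ⟦ j ∸ l ⟧) l (j ∸ l))   ≡⟨ antidiagonal-sum≡0 (λ l u → f′ (⟦ l ⟧ + ⟦ u ⟧) l u) g corner left bottom inner j ⟩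
  0ℚ                                                ∎
  where
  open ≡-Reasoning
  f′ : ℚ → ℕ → ℕ → ℚ
  f′ s l u = a s * F l u + b s * G l u + c s * H l u

-- Eberlein polynomials: two contiguous relations

-- E j y N P depends on N only through M = N - P, which stays fixed under x ↦ x ± 1.
eberleinTerm : (y P M : ℚ) → ℕ → ℕ → ℚ
eberleinTerm y P M l u = sgn l * binom y l * binom (P - y) u * binom (M - y) u

eberlein : ℕ → (y P M : ℚ) → ℚ
eberlein j y P M = sumTo j (λ l → eberleinTerm y P M l (j ∸ l))

E≡eberlein : ∀ j y N P {M} → N - P ≡ M → E j y N P ≡ eberlein j y P M
E≡eberlein j y N P refl = refl

module EberleinShiftP (y P M : ℚ) where

  summand : ℕ → ℕ → ℚ
  summand l u = (- (P - y + 1ℚ)) * eberleinTerm y (P + 1ℚ) M l u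
              + (y - M) * eberleinTerm (y + 1ℚ) (P + 1ℚ) M l u
              + (M + P - y - y + 1ℚ) * eberleinTerm y P M l u

  flux : ℕ → ℕ → ℚ
  flux l u = (M - y) * (sgn (suc l) * binom y l * binom (P - y) u * binom (M - y - 1ℚ) u)

  private
    inner-identity : ∀ (L U S Fy Iy Fp Fm Iu b₁ b₂ b₃ b₄ b₅ b₆ b₇ b₈ b₉ b₁₀ b₁₁ : ℚ) →
      b₁ ≡ Fy * (y - L) * Iy → b₂ ≡ ((P + 1ℚ) - y) * Fp * Iu → b₃ ≡ (M - y) * Fm * Iu →
      b₄ ≡ (y + 1ℚ) * Fy * Iy → b₅ ≡ Fp * ((P - y) - U) * Iu → b₆ ≡ Fm * ((M - y - 1ℚ) - U) * Iu →
      b₇ ≡ Fp * ((P - y) - U) * Iu → b₈ ≡ Fp * (Iu * (U + 1ℚ)) → b₉ ≡ Fm * (Iu * (U + 1ℚ)) →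
      b₁₀ ≡ Fy * (Iy * (L + 1ℚ)) → b₁₁ ≡ Fm * ((M - y - 1ℚ) - U) * Iu →
      (- (P - y + 1ℚ)) * (S * (- 1ℚ) * b₁ * b₂ * b₃) + (y - M) * (S * (- 1ℚ) * b₄ * b₅ * b₆)
        + (M + P - y - y + 1ℚ) * (S * (- 1ℚ) * b₁ * b₇ * b₃)
      ≡ (M - y) * (S * (- 1ℚ) * (- 1ℚ) * b₁ * b₈ * b₉) - (M - y) * (S * (- 1ℚ) * b₁₀ * b₇ * b₁₁)
    inner-identity L U S Fy Iy Fp Fm Iu _ _ _ _ _ _ _ _ _ _ _
                   refl refl refl refl refl refl refl refl refl refl refl =
      solve (y ∷ P ∷ M ∷ L ∷ U ∷ S ∷ Fy ∷ Iy ∷ Fp ∷ Fm ∷ Iu ∷ []) ℚ-ring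

    left-identity : ∀ (U Fp Fm Iu b₂ b₃ b₅ b₆ b₇ b₈ b₉ : ℚ) →
      b₂ ≡ ((P + 1ℚ) - y) * Fp * Iu → b₃ ≡ (M - y) * Fm * Iu → b₅ ≡ Fp * ((P - y) - U) * Iu →
      b₆ ≡ Fm * ((M - y - 1ℚ) - U) * Iu → b₇ ≡ Fp * ((P - y) - U) * Iu →
      b₈ ≡ Fp * (Iu * (U + 1ℚ)) → b₉ ≡ Fm * (Iu * (U + 1ℚ)) →
      (- (P - y + 1ℚ)) * (1ℚ * 1ℚ * b₂ * b₃) + (y - M) * (1ℚ * 1ℚ * b₅ * b₆)
        + (M + P - y - y + 1ℚ) * (1ℚ * 1ℚ * b₇ * b₃)
      ≡ (M - y) * (1ℚ * (- 1ℚ) * 1ℚ * b₈ * b₉)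
    left-identity U Fp Fm Iu _ _ _ _ _ _ _ refl refl refl refl refl refl refl =
      solve (y ∷ P ∷ M ∷ U ∷ Fp ∷ Fm ∷ Iu ∷ []) ℚ-ring

    bottom-identity : ∀ (L S Fy Iy b₁ b₄ b₁₀ : ℚ) →
      b₁ ≡ Fy * (y - L) * Iy → b₄ ≡ (y + 1ℚ) * Fy * Iy → b₁₀ ≡ Fy * (Iy * (L + 1ℚ)) →
      (- (P - y + 1ℚ)) * (S * (- 1ℚ) * b₁ * 1ℚ * 1ℚ) + (y - M) * (S * (- 1ℚ) * b₄ * 1ℚ * 1ℚ)
        + (M + P - y - y + 1ℚ) * (S * (- 1ℚ) * b₁ * 1ℚ * 1ℚ)
      ≡ - ((M - y) * (S * (- 1ℚ) * b₁₀ * 1ℚ * 1ℚ))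
    bottom-identity L S Fy Iy _ _ _ refl refl refl = solve (y ∷ P ∷ M ∷ L ∷ S ∷ Fy ∷ Iy ∷ []) ℚ-ring

    corner-identity : (- (P - y + 1ℚ)) * (1ℚ * 1ℚ * 1ℚ * 1ℚ) + (y - M) * (1ℚ * 1ℚ * 1ℚ * 1ℚ)
                        + (M + P - y - y + 1ℚ) * (1ℚ * 1ℚ * 1ℚ * 1ℚ) ≡ 0ℚ
    corner-identity = solve (y ∷ P ∷ M ∷ []) ℚ-ring

    P+1-y : (P + 1ℚ) - y ≡ (P - y) + 1ℚ
    P+1-y = solve (P ∷ y ∷ []) ℚ-ring

    M-y : M - y ≡ (M - y - 1ℚ) + 1ℚ
    M-y = solve (M ∷ y ∷ []) ℚ-ring

    P+1-[y+1] : (P + 1ℚ) - (y + 1ℚ) ≡ P - y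
    P+1-[y+1] = solve (P ∷ y ∷ []) ℚ-ring

    M-[y+1] : M - (y + 1ℚ) ≡ M - y - 1ℚ
    M-[y+1] = solve (M ∷ y ∷ []) ℚ-ring

    inner : ∀ l u → summand (suc l) (suc u) ≡ flux (suc l) u - flux l (suc u)
    inner l u =
      inner-identity ⟦ l ⟧ ⟦ u ⟧ (sgn l) (falling y l) (invFactorial (suc l))
        (falling (P - y) u) (falling (M - y - 1ℚ) u) (invFactorial (suc u)) _ _ _ _ _ _ _ _ _ _ _
        (binom-suc y l refl) (binom-suc-upper (P - y) u P+1-y) (binom-suc-upper (M - y - 1ℚ) u M-y)
        (binom-suc-upper y l refl) (binom-suc (P - y) u P+1-[y+1]) (binom-suc (M - y - 1ℚ) u M-[y+1])
        (binom-suc (P - y) u refl) (binom-lower (P - y) u) (binom-lower (M - y - 1ℚ) u)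
        (binom-lower y l) (binom-suc (M - y - 1ℚ) u refl)

    left : ∀ u → summand 0 (suc u) ≡ flux 0 u
    left u =
      left-identity ⟦ u ⟧ (falling (P - y) u) (falling (M - y - 1ℚ) u) (invFactorial (suc u)) _ _ _ _ _ _ _
        (binom-suc-upper (P - y) u P+1-y) (binom-suc-upper (M - y - 1ℚ) u M-y)
        (binom-suc (P - y) u P+1-[y+1]) (binom-suc (M - y - 1ℚ) u M-[y+1])
        (binom-suc (P - y) u refl) (binom-lower (P - y) u) (binom-lower (M - y - 1ℚ) u)

    bottom : ∀ l → summand (suc l) 0 ≡ - flux l 0
    bottom l = bottom-identity ⟦ l ⟧ (sgn l) (falling y l) (invFactorial (suc l)) _ _ _
      (binom-suc y l refl) (binom-suc-upper y l refl) (binom-lower y l)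

  relation : ∀ j → (- (P - y + 1ℚ)) * eberlein j y (P + 1ℚ) M + (y - M) * eberlein j (y + 1ℚ) (P + 1ℚ) M
                     + (M + P - y - y + 1ℚ) * eberlein j y P M ≡ 0ℚ
  relation = antidiagonal-relation (λ _ → - (P - y + 1ℚ)) (λ _ → y - M) (λ _ → M + P - y - y + 1ℚ)
    (eberleinTerm y (P + 1ℚ) M) (eberleinTerm (y + 1ℚ) (P + 1ℚ) M) (eberleinTerm y P M) flux
    corner-identity left bottom inner

module EberleinShiftQ (y Q M : ℚ) where

  summand : ℕ → ℕ → ℚ
  summand l u = (- ((M + Q - y + 1ℚ + 1ℚ) * (Q + 1ℚ - y))) * eberleinTerm y Q M l u
              + (y * (y - M - 1ℚ)) * eberleinTerm (y - 1ℚ) Q M l u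
              + ((M + Q - y - y + 1ℚ + 1ℚ) * (Q + 1ℚ - (⟦ l ⟧ + ⟦ u ⟧))) * eberleinTerm y (Q + 1ℚ) M l u

  flux : ℕ → ℕ → ℚ
  flux l u = (y * (Q + 1ℚ - y)) * (sgn (suc l) * binom (y - 1ℚ) l * binom (Q - y) u * binom (M - y) u)

  private
    inner-identity : ∀ (L U S Fy Iy Fq Fm Iu b₁ b₂ b₃ b₄ b₅ b₆ b₇ b₈ b₉ b₁₀ l₁ u₁ : ℚ) →
      b₁ ≡ y * Fy * Iy → b₂ ≡ Fq * ((Q - y) - U) * Iu → b₃ ≡ Fm * ((M - y) - U) * Iu →
      b₄ ≡ Fy * ((y - 1ℚ) - L) * Iy → b₅ ≡ (Q - (y - 1ℚ)) * Fq * Iu → b₆ ≡ (M - (y - 1ℚ)) * Fm * Iu →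
      b₇ ≡ ((Q + 1ℚ) - y) * Fq * Iu → b₈ ≡ Fq * (Iu * (U + 1ℚ)) → b₉ ≡ Fm * (Iu * (U + 1ℚ)) →
      b₁₀ ≡ Fy * (Iy * (L + 1ℚ)) → l₁ ≡ L + 1ℚ → u₁ ≡ U + 1ℚ →
      (- ((M + Q - y + 1ℚ + 1ℚ) * (Q + 1ℚ - y))) * (S * (- 1ℚ) * b₁ * b₂ * b₃)
        + (y * (y - M - 1ℚ)) * (S * (- 1ℚ) * b₄ * b₅ * b₆)
        + ((M + Q - y - y + 1ℚ + 1ℚ) * (Q + 1ℚ - (l₁ + u₁))) * (S * (- 1ℚ) * b₁ * b₇ * b₃)
      ≡ (y * (Q + 1ℚ - y)) * (S * (- 1ℚ) * (- 1ℚ) * b₄ * b₈ * b₉)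
        - (y * (Q + 1ℚ - y)) * (S * (- 1ℚ) * b₁₀ * b₂ * b₃)
    inner-identity L U S Fy Iy Fq Fm Iu _ _ _ _ _ _ _ _ _ _ _ _
                   refl refl refl refl refl refl refl refl refl refl refl refl =
      solve (y ∷ Q ∷ M ∷ L ∷ U ∷ S ∷ Fy ∷ Iy ∷ Fq ∷ Fm ∷ Iu ∷ []) ℚ-ring

    left-identity : ∀ (U Fq Fm Iu b₂ b₃ b₅ b₆ b₇ b₈ b₉ u₁ : ℚ) →
      b₂ ≡ Fq * ((Q - y) - U) * Iu → b₃ ≡ Fm * ((M - y) - U) * Iu → b₅ ≡ (Q - (y - 1ℚ)) * Fq * Iu →
      b₆ ≡ (M - (y - 1ℚ)) * Fm * Iu → b₇ ≡ ((Q + 1ℚ) - y) * Fq * Iu →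
      b₈ ≡ Fq * (Iu * (U + 1ℚ)) → b₉ ≡ Fm * (Iu * (U + 1ℚ)) → u₁ ≡ U + 1ℚ →
      (- ((M + Q - y + 1ℚ + 1ℚ) * (Q + 1ℚ - y))) * (1ℚ * 1ℚ * b₂ * b₃)
        + (y * (y - M - 1ℚ)) * (1ℚ * 1ℚ * b₅ * b₆)
        + ((M + Q - y - y + 1ℚ + 1ℚ) * (Q + 1ℚ - (0ℚ + u₁))) * (1ℚ * 1ℚ * b₇ * b₃)
      ≡ (y * (Q + 1ℚ - y)) * (1ℚ * (- 1ℚ) * 1ℚ * b₈ * b₉)
    left-identity U Fq Fm Iu _ _ _ _ _ _ _ _ refl refl refl refl refl refl refl refl =
      solve (y ∷ Q ∷ M ∷ U ∷ Fq ∷ Fm ∷ Iu ∷ []) ℚ-ring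

    bottom-identity : ∀ (L S Fy Iy b₁ b₄ b₁₀ l₁ : ℚ) →
      b₁ ≡ y * Fy * Iy → b₄ ≡ Fy * ((y - 1ℚ) - L) * Iy → b₁₀ ≡ Fy * (Iy * (L + 1ℚ)) → l₁ ≡ L + 1ℚ →
      (- ((M + Q - y + 1ℚ + 1ℚ) * (Q + 1ℚ - y))) * (S * (- 1ℚ) * b₁ * 1ℚ * 1ℚ)
        + (y * (y - M - 1ℚ)) * (S * (- 1ℚ) * b₄ * 1ℚ * 1ℚ)
        + ((M + Q - y - y + 1ℚ + 1ℚ) * (Q + 1ℚ - (l₁ + 0ℚ))) * (S * (- 1ℚ) * b₁ * 1ℚ * 1ℚ)
      ≡ - ((y * (Q + 1ℚ - y)) * (S * (- 1ℚ) * b₁₀ * 1ℚ * 1ℚ))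
    bottom-identity L S Fy Iy _ _ _ _ refl refl refl refl = solve (y ∷ Q ∷ M ∷ L ∷ S ∷ Fy ∷ Iy ∷ []) ℚ-ring

    corner-identity : (- ((M + Q - y + 1ℚ + 1ℚ) * (Q + 1ℚ - y))) * (1ℚ * 1ℚ * 1ℚ * 1ℚ)
                        + (y * (y - M - 1ℚ)) * (1ℚ * 1ℚ * 1ℚ * 1ℚ)
                        + ((M + Q - y - y + 1ℚ + 1ℚ) * (Q + 1ℚ - (0ℚ + 0ℚ))) * (1ℚ * 1ℚ * 1ℚ * 1ℚ) ≡ 0ℚ
    corner-identity = solve (y ∷ Q ∷ M ∷ []) ℚ-ring

    y-1+1 : y ≡ (y - 1ℚ) + 1ℚ
    y-1+1 = solve (y ∷ []) ℚ-ring

    Q-[y-1] : Q - (y - 1ℚ) ≡ (Q - y) + 1ℚ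
    Q-[y-1] = solve (Q ∷ y ∷ []) ℚ-ring

    M-[y-1] : M - (y - 1ℚ) ≡ (M - y) + 1ℚ
    M-[y-1] = solve (M ∷ y ∷ []) ℚ-ring

    Q+1-y : (Q + 1ℚ) - y ≡ (Q - y) + 1ℚ
    Q+1-y = solve (Q ∷ y ∷ []) ℚ-ring

    inner : ∀ l u → summand (suc l) (suc u) ≡ flux (suc l) u - flux l (suc u)
    inner l u =
      inner-identity ⟦ l ⟧ ⟦ u ⟧ (sgn l) (falling (y - 1ℚ) l) (invFactorial (suc l))
        (falling (Q - y) u) (falling (M - y) u) (invFactorial (suc u)) _ _ _ _ _ _ _ _ _ _ _ _
        (binom-suc-upper (y - 1ℚ) l y-1+1) (binom-suc (Q - y) u refl) (binom-suc (M - y) u refl)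
        (binom-suc (y - 1ℚ) l refl) (binom-suc-upper (Q - y) u Q-[y-1]) (binom-suc-upper (M - y) u M-[y-1])
        (binom-suc-upper (Q - y) u Q+1-y) (binom-lower (Q - y) u) (binom-lower (M - y) u)
        (binom-lower (y - 1ℚ) l) (⟦⟧-suc l) (⟦⟧-suc u)

    left : ∀ u → summand 0 (suc u) ≡ flux 0 u
    left u =
      left-identity ⟦ u ⟧ (falling (Q - y) u) (falling (M - y) u) (invFactorial (suc u)) _ _ _ _ _ _ _ _
        (binom-suc (Q - y) u refl) (binom-suc (M - y) u refl)
        (binom-suc-upper (Q - y) u Q-[y-1]) (binom-suc-upper (M - y) u M-[y-1])
        (binom-suc-upper (Q - y) u Q+1-y) (binom-lower (Q - y) u) (binom-lower (M - y) u) (⟦⟧-suc u)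

    bottom : ∀ l → summand (suc l) 0 ≡ - flux l 0
    bottom l = bottom-identity ⟦ l ⟧ (sgn l) (falling (y - 1ℚ) l) (invFactorial (suc l)) _ _ _ _
      (binom-suc-upper (y - 1ℚ) l y-1+1) (binom-suc (y - 1ℚ) l refl) (binom-lower (y - 1ℚ) l) (⟦⟧-suc l)

  relation : ∀ j → (- ((M + Q - y + 1ℚ + 1ℚ) * (Q + 1ℚ - y))) * eberlein j y Q M
                     + (y * (y - M - 1ℚ)) * eberlein j (y - 1ℚ) Q M
                     + ((M + Q - y - y + 1ℚ + 1ℚ) * (Q + 1ℚ - ⟦ j ⟧)) * eberlein j y (Q + 1ℚ) M ≡ 0ℚ
  relation = antidiagonal-relation (λ _ → - ((M + Q - y + 1ℚ + 1ℚ) * (Q + 1ℚ - y))) (λ _ → y * (y - M - 1ℚ))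
    (λ s → (M + Q - y - y + 1ℚ + 1ℚ) * (Q + 1ℚ - s))
    (eberleinTerm y Q M) (eberleinTerm (y - 1ℚ) Q M) (eberleinTerm y (Q + 1ℚ) M) flux
    corner-identity left bottom inner

-- Krawtchouk polynomials: the three-term recurrence in x

krawtchoukTerm : (x N p : ℚ) → ℕ → ℕ → ℚ
krawtchoukTerm x N p l u = sgn l * ((p - 1ℚ) ^ℚ u) * binom x l * binom (N - x) u

module KrawtchoukRecurrence (x N p : ℚ) where

  summand : ℕ → ℕ → ℚ
  summand l u = ((p - 1ℚ) * (N - x)) * krawtchoukTerm (x + 1ℚ) N p l u
              + (- ((p - 1ℚ) * (N - x) + x - p * (⟦ l ⟧ + ⟦ u ⟧))) * krawtchoukTerm x N p l u
              + x * krawtchoukTerm (x - 1ℚ) N p l u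

  flux : ℕ → ℕ → ℚ
  flux l u = (⟦ l ⟧ + ⟦ u ⟧ - N) * (sgn (suc l) * ((p - 1ℚ) ^ℚ (suc u)) * binom x l * binom (N - x) u)

  private
    -- S = sgn l, C = (p - 1)^u, ℓ = ⟦ l ⟧, ℓ₁ = ⟦ suc l ⟧, υ = ⟦ u ⟧, υ₁ = ⟦ suc u ⟧; the b's are binomials
    -- with upper argument x + 1, x, x - 1, the w's with upper argument N - x shifted accordingly.
    InnerIdentity : (S C ℓ ℓ₁ υ υ₁ b₊ b₀ b₋ bₗ w₋ w₀ w₊ wᵤ : ℚ) → Set
    InnerIdentity S C ℓ ℓ₁ υ υ₁ b₊ b₀ b₋ bₗ w₋ w₀ w₊ wᵤ =
      ((p - 1ℚ) * (N - x)) * (S * (- 1ℚ) * (C * (p - 1ℚ)) * b₊ * w₋)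
        + (- ((p - 1ℚ) * (N - x) + x - p * (ℓ₁ + υ₁))) * (S * (- 1ℚ) * (C * (p - 1ℚ)) * b₀ * w₀)
        + x * (S * (- 1ℚ) * (C * (p - 1ℚ)) * b₋ * w₊)
      ≡ (ℓ₁ + υ - N) * (S * (- 1ℚ) * (- 1ℚ) * (C * (p - 1ℚ)) * b₀ * wᵤ)
        - (ℓ + υ₁ - N) * (S * (- 1ℚ) * ((C * (p - 1ℚ)) * (p - 1ℚ)) * bₗ * w₀)

    inner-suc-suc : ∀ (S C L U Fx Ix Fw Iw ℓ ℓ₁ υ υ₁ b₊ b₀ b₋ bₗ w₋ w₀ w₊ wᵤ : ℚ) →
      b₊ ≡ (x + 1ℚ) * ((x - 1ℚ + 1ℚ) * Fx) * Ix → b₀ ≡ x * Fx * (x - ℓ) * Ix →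
      b₋ ≡ Fx * ((x - 1ℚ) - L) * ((x - 1ℚ) - ℓ) * Ix → bₗ ≡ x * Fx * (Ix * (ℓ + 1ℚ)) →
      ℓ ≡ L + 1ℚ → ℓ₁ ≡ (L + 1ℚ) + 1ℚ →
      w₊ ≡ (N - (x - 1ℚ)) * ((N - x - 1ℚ + 1ℚ) * Fw) * Iw → w₀ ≡ (N - x) * Fw * ((N - x) - υ) * Iw →
      w₋ ≡ Fw * ((N - x - 1ℚ) - U) * ((N - x - 1ℚ) - υ) * Iw → wᵤ ≡ (N - x) * Fw * (Iw * (υ + 1ℚ)) →
      υ ≡ U + 1ℚ → υ₁ ≡ (U + 1ℚ) + 1ℚ →
      InnerIdentity S C ℓ ℓ₁ υ υ₁ b₊ b₀ b₋ bₗ w₋ w₀ w₊ wᵤ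
    inner-suc-suc S C L U Fx Ix Fw Iw _ _ _ _ _ _ _ _ _ _ _ _
                  refl refl refl refl refl refl refl refl refl refl refl refl =
      solve (x ∷ N ∷ p ∷ S ∷ C ∷ L ∷ U ∷ Fx ∷ Ix ∷ Fw ∷ Iw ∷ []) ℚ-ring

    inner-zero-suc : ∀ (S C U Fw Iw ℓ ℓ₁ υ υ₁ b₊ b₀ b₋ bₗ w₋ w₀ w₊ wᵤ : ℚ) →
      b₊ ≡ x + 1ℚ → b₀ ≡ x → b₋ ≡ x - 1ℚ → bₗ ≡ 1ℚ → ℓ ≡ 0ℚ → ℓ₁ ≡ 1ℚ →
      w₊ ≡ (N - (x - 1ℚ)) * ((N - x - 1ℚ + 1ℚ) * Fw) * Iw → w₀ ≡ (N - x) * Fw * ((N - x) - υ) * Iw →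
      w₋ ≡ Fw * ((N - x - 1ℚ) - U) * ((N - x - 1ℚ) - υ) * Iw → wᵤ ≡ (N - x) * Fw * (Iw * (υ + 1ℚ)) →
      υ ≡ U + 1ℚ → υ₁ ≡ (U + 1ℚ) + 1ℚ →
      InnerIdentity S C ℓ ℓ₁ υ υ₁ b₊ b₀ b₋ bₗ w₋ w₀ w₊ wᵤ
    inner-zero-suc S C U Fw Iw _ _ _ _ _ _ _ _ _ _ _ _
                   refl refl refl refl refl refl refl refl refl refl refl refl =
      solve (x ∷ N ∷ p ∷ S ∷ C ∷ U ∷ Fw ∷ Iw ∷ []) ℚ-ring

    inner-suc-zero : ∀ (S C L Fx Ix ℓ ℓ₁ υ υ₁ b₊ b₀ b₋ bₗ w₋ w₀ w₊ wᵤ : ℚ) →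
      b₊ ≡ (x + 1ℚ) * ((x - 1ℚ + 1ℚ) * Fx) * Ix → b₀ ≡ x * Fx * (x - ℓ) * Ix →
      b₋ ≡ Fx * ((x - 1ℚ) - L) * ((x - 1ℚ) - ℓ) * Ix → bₗ ≡ x * Fx * (Ix * (ℓ + 1ℚ)) →
      ℓ ≡ L + 1ℚ → ℓ₁ ≡ (L + 1ℚ) + 1ℚ →
      w₊ ≡ N - (x - 1ℚ) → w₀ ≡ N - x → w₋ ≡ N - (x + 1ℚ) → wᵤ ≡ 1ℚ → υ ≡ 0ℚ → υ₁ ≡ 1ℚ →
      InnerIdentity S C ℓ ℓ₁ υ υ₁ b₊ b₀ b₋ bₗ w₋ w₀ w₊ wᵤ
    inner-suc-zero S C L Fx Ix _ _ _ _ _ _ _ _ _ _ _ _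
                   refl refl refl refl refl refl refl refl refl refl refl refl =
      solve (x ∷ N ∷ p ∷ S ∷ C ∷ L ∷ Fx ∷ Ix ∷ []) ℚ-ring

    inner-zero-zero : ∀ (S C ℓ ℓ₁ υ υ₁ b₊ b₀ b₋ bₗ w₋ w₀ w₊ wᵤ : ℚ) →
      b₊ ≡ x + 1ℚ → b₀ ≡ x → b₋ ≡ x - 1ℚ → bₗ ≡ 1ℚ → ℓ ≡ 0ℚ → ℓ₁ ≡ 1ℚ →
      w₊ ≡ N - (x - 1ℚ) → w₀ ≡ N - x → w₋ ≡ N - (x + 1ℚ) → wᵤ ≡ 1ℚ → υ ≡ 0ℚ → υ₁ ≡ 1ℚ →
      InnerIdentity S C ℓ ℓ₁ υ υ₁ b₊ b₀ b₋ bₗ w₋ w₀ w₊ wᵤ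
    inner-zero-zero S C _ _ _ _ _ _ _ _ _ _ _ _ refl refl refl refl refl refl refl refl refl refl refl refl =
      solve (x ∷ N ∷ p ∷ S ∷ C ∷ []) ℚ-ring

    LeftIdentity : (C ℓ υ υ₁ w₋ w₀ w₊ wᵤ : ℚ) → Set
    LeftIdentity C ℓ υ υ₁ w₋ w₀ w₊ wᵤ =
      ((p - 1ℚ) * (N - x)) * (1ℚ * (C * (p - 1ℚ)) * 1ℚ * w₋)
        + (- ((p - 1ℚ) * (N - x) + x - p * (ℓ + υ₁))) * (1ℚ * (C * (p - 1ℚ)) * 1ℚ * w₀)
        + x * (1ℚ * (C * (p - 1ℚ)) * 1ℚ * w₊)
      ≡ (ℓ + υ - N) * (1ℚ * (- 1ℚ) * (C * (p - 1ℚ)) * 1ℚ * wᵤ)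

    left-suc : ∀ (C U Fw Iw ℓ υ υ₁ w₋ w₀ w₊ wᵤ : ℚ) → ℓ ≡ 0ℚ →
      w₊ ≡ (N - (x - 1ℚ)) * ((N - x - 1ℚ + 1ℚ) * Fw) * Iw → w₀ ≡ (N - x) * Fw * ((N - x) - υ) * Iw →
      w₋ ≡ Fw * ((N - x - 1ℚ) - U) * ((N - x - 1ℚ) - υ) * Iw → wᵤ ≡ (N - x) * Fw * (Iw * (υ + 1ℚ)) →
      υ ≡ U + 1ℚ → υ₁ ≡ (U + 1ℚ) + 1ℚ →
      LeftIdentity C ℓ υ υ₁ w₋ w₀ w₊ wᵤ
    left-suc C U Fw Iw _ _ _ _ _ _ _ refl refl refl refl refl refl refl =
      solve (x ∷ N ∷ p ∷ C ∷ U ∷ Fw ∷ Iw ∷ []) ℚ-ring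

    left-zero : ∀ (C ℓ υ υ₁ w₋ w₀ w₊ wᵤ : ℚ) → ℓ ≡ 0ℚ →
      w₊ ≡ N - (x - 1ℚ) → w₀ ≡ N - x → w₋ ≡ N - (x + 1ℚ) → wᵤ ≡ 1ℚ → υ ≡ 0ℚ → υ₁ ≡ 1ℚ →
      LeftIdentity C ℓ υ υ₁ w₋ w₀ w₊ wᵤ
    left-zero C _ _ _ _ _ _ _ refl refl refl refl refl refl refl = solve (x ∷ N ∷ p ∷ C ∷ []) ℚ-ring

    BottomIdentity : (S ℓ ℓ₁ υ b₊ b₀ b₋ bₗ : ℚ) → Set
    BottomIdentity S ℓ ℓ₁ υ b₊ b₀ b₋ bₗ =
      ((p - 1ℚ) * (N - x)) * (S * (- 1ℚ) * 1ℚ * b₊ * 1ℚ)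
        + (- ((p - 1ℚ) * (N - x) + x - p * (ℓ₁ + υ))) * (S * (- 1ℚ) * 1ℚ * b₀ * 1ℚ)
        + x * (S * (- 1ℚ) * 1ℚ * b₋ * 1ℚ)
      ≡ - ((ℓ + υ - N) * (S * (- 1ℚ) * (1ℚ * (p - 1ℚ)) * bₗ * 1ℚ))

    bottom-suc : ∀ (S L Fx Ix ℓ ℓ₁ υ b₊ b₀ b₋ bₗ : ℚ) → υ ≡ 0ℚ →
      b₊ ≡ (x + 1ℚ) * ((x - 1ℚ + 1ℚ) * Fx) * Ix → b₀ ≡ x * Fx * (x - ℓ) * Ix →
      b₋ ≡ Fx * ((x - 1ℚ) - L) * ((x - 1ℚ) - ℓ) * Ix → bₗ ≡ x * Fx * (Ix * (ℓ + 1ℚ)) →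
      ℓ ≡ L + 1ℚ → ℓ₁ ≡ (L + 1ℚ) + 1ℚ →
      BottomIdentity S ℓ ℓ₁ υ b₊ b₀ b₋ bₗ
    bottom-suc S L Fx Ix _ _ _ _ _ _ _ refl refl refl refl refl refl refl =
      solve (x ∷ N ∷ p ∷ S ∷ L ∷ Fx ∷ Ix ∷ []) ℚ-ring

    bottom-zero : ∀ (S ℓ ℓ₁ υ b₊ b₀ b₋ bₗ : ℚ) → υ ≡ 0ℚ →
      b₊ ≡ x + 1ℚ → b₀ ≡ x → b₋ ≡ x - 1ℚ → bₗ ≡ 1ℚ → ℓ ≡ 0ℚ → ℓ₁ ≡ 1ℚ →
      BottomIdentity S ℓ ℓ₁ υ b₊ b₀ b₋ bₗ
    bottom-zero S _ _ _ _ _ _ _ refl refl refl refl refl refl refl = solve (x ∷ N ∷ p ∷ S ∷ []) ℚ-ring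

    corner-identity : ((p - 1ℚ) * (N - x)) * (1ℚ * 1ℚ * 1ℚ * 1ℚ)
                        + (- ((p - 1ℚ) * (N - x) + x - p * (0ℚ + 0ℚ))) * (1ℚ * 1ℚ * 1ℚ * 1ℚ)
                        + x * (1ℚ * 1ℚ * 1ℚ * 1ℚ) ≡ 0ℚ
    corner-identity = solve (x ∷ N ∷ p ∷ []) ℚ-ring

    ⟦2+⟧ : ∀ n → ⟦ suc (suc n) ⟧ ≡ (⟦ n ⟧ + 1ℚ) + 1ℚ
    ⟦2+⟧ n = trans (⟦⟧-suc (suc n)) (cong (_+ 1ℚ) (⟦⟧-suc n))

    x+1 : x + 1ℚ ≡ ((x - 1ℚ) + 1ℚ) + 1ℚ
    x+1 = solve (x ∷ []) ℚ-ring

    x-1+1 : x ≡ (x - 1ℚ) + 1ℚ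
    x-1+1 = solve (x ∷ []) ℚ-ring

    N-[x-1] : N - (x - 1ℚ) ≡ ((N - x - 1ℚ) + 1ℚ) + 1ℚ
    N-[x-1] = solve (N ∷ x ∷ []) ℚ-ring

    N-x : N - x ≡ (N - x - 1ℚ) + 1ℚ
    N-x = solve (N ∷ x ∷ []) ℚ-ring

    N-[x+1] : N - (x + 1ℚ) ≡ N - x - 1ℚ
    N-[x+1] = solve (N ∷ x ∷ []) ℚ-ring

    inner : ∀ l u → summand (suc l) (suc u) ≡ flux (suc l) u - flux l (suc u)
    inner (suc l) (suc u) =
      inner-suc-suc (sgn (suc l)) ((p - 1ℚ) ^ℚ suc u) ⟦ l ⟧ ⟦ u ⟧ (falling (x - 1ℚ) l)
        (invFactorial (suc (suc l))) (falling (N - x - 1ℚ) u) (invFactorial (suc (suc u)))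
        _ _ _ _ _ _ _ _ _ _ _ _
        (binom-2+-upper² (x - 1ℚ) l x+1) (binom-2+-upper (x - 1ℚ) l x-1+1) (binom-2+ (x - 1ℚ) l refl)
        (binom-suc-upper-lower (x - 1ℚ) l x-1+1) (⟦⟧-suc l) (⟦2+⟧ l)
        (binom-2+-upper² (N - x - 1ℚ) u N-[x-1]) (binom-2+-upper (N - x - 1ℚ) u N-x)
        (binom-2+ (N - x - 1ℚ) u N-[x+1]) (binom-suc-upper-lower (N - x - 1ℚ) u N-x) (⟦⟧-suc u) (⟦2+⟧ u)
    inner zero (suc u) =
      inner-zero-suc 1ℚ ((p - 1ℚ) ^ℚ suc u) ⟦ u ⟧ (falling (N - x - 1ℚ) u) (invFactorial (suc (suc u)))
        _ _ _ _ _ _ _ _ _ _ _ _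
        (binom-1 _) (binom-1 _) (binom-1 _) refl refl refl
        (binom-2+-upper² (N - x - 1ℚ) u N-[x-1]) (binom-2+-upper (N - x - 1ℚ) u N-x)
        (binom-2+ (N - x - 1ℚ) u N-[x+1]) (binom-suc-upper-lower (N - x - 1ℚ) u N-x) (⟦⟧-suc u) (⟦2+⟧ u)
    inner (suc l) zero =
      inner-suc-zero (sgn (suc l)) 1ℚ ⟦ l ⟧ (falling (x - 1ℚ) l) (invFactorial (suc (suc l)))
        _ _ _ _ _ _ _ _ _ _ _ _
        (binom-2+-upper² (x - 1ℚ) l x+1) (binom-2+-upper (x - 1ℚ) l x-1+1) (binom-2+ (x - 1ℚ) l refl)
        (binom-suc-upper-lower (x - 1ℚ) l x-1+1) (⟦⟧-suc l) (⟦2+⟧ l)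
        (binom-1 _) (binom-1 _) (binom-1 _) refl refl refl
    inner zero zero =
      inner-zero-zero 1ℚ 1ℚ _ _ _ _ _ _ _ _ _ _ _ _
        (binom-1 _) (binom-1 _) (binom-1 _) refl refl refl (binom-1 _) (binom-1 _) (binom-1 _) refl refl refl

    left : ∀ u → summand 0 (suc u) ≡ flux 0 u
    left (suc u) =
      left-suc ((p - 1ℚ) ^ℚ suc u) ⟦ u ⟧ (falling (N - x - 1ℚ) u) (invFactorial (suc (suc u)))
        _ _ _ _ _ _ _ refl
        (binom-2+-upper² (N - x - 1ℚ) u N-[x-1]) (binom-2+-upper (N - x - 1ℚ) u N-x)
        (binom-2+ (N - x - 1ℚ) u N-[x+1]) (binom-suc-upper-lower (N - x - 1ℚ) u N-x) (⟦⟧-suc u) (⟦2+⟧ u)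
    left zero = left-zero 1ℚ _ _ _ _ _ _ _ refl (binom-1 _) (binom-1 _) (binom-1 _) refl refl refl

    bottom : ∀ l → summand (suc l) 0 ≡ - flux l 0
    bottom (suc l) =
      bottom-suc (sgn (suc l)) ⟦ l ⟧ (falling (x - 1ℚ) l) (invFactorial (suc (suc l))) _ _ _ _ _ _ _ refl
        (binom-2+-upper² (x - 1ℚ) l x+1) (binom-2+-upper (x - 1ℚ) l x-1+1) (binom-2+ (x - 1ℚ) l refl)
        (binom-suc-upper-lower (x - 1ℚ) l x-1+1) (⟦⟧-suc l) (⟦2+⟧ l)
    bottom zero = bottom-zero 1ℚ _ _ _ _ _ _ _ refl (binom-1 _) (binom-1 _) (binom-1 _) refl refl refl

  relation : ∀ i → ((p - 1ℚ) * (N - x)) * K i (x + 1ℚ) N p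
                     + (- ((p - 1ℚ) * (N - x) + x - p * ⟦ i ⟧)) * K i x N p
                     + x * K i (x - 1ℚ) N p ≡ 0ℚ
  relation = antidiagonal-relation (λ _ → (p - 1ℚ) * (N - x)) (λ s → - ((p - 1ℚ) * (N - x) + x - p * s)) (λ _ → x)
    (krawtchoukTerm (x + 1ℚ) N p) (krawtchoukTerm x N p) (krawtchoukTerm (x - 1ℚ) N p) flux
    corner-identity left bottom inner

three-term-cong : ∀ a b c {u u′ v v′ w w′ : ℚ} → u ≡ u′ → v ≡ v′ → w ≡ w′ →
  a * u′ + b * v′ + c * w′ ≡ 0ℚ → a * u + b * v + c * w ≡ 0ℚ
three-term-cong a b c refl refl refl relation = relation

[N+1]-[P+1] : ∀ N P → (N + 1ℚ) - (P + 1ℚ) ≡ N - P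
[N+1]-[P+1] = solve-∀ ℚ-ring

eberlein-shiftP : ∀ j y N P {N₊ P₊} → N₊ ≡ N + 1ℚ → P₊ ≡ P + 1ℚ →
  (- (P - y + 1ℚ)) * E j y N₊ P₊ + (y - (N - P)) * E j (y + 1ℚ) N₊ P₊
    + ((N - P) + P - y - y + 1ℚ) * E j y N P ≡ 0ℚ
eberlein-shiftP j y N P refl refl =
  three-term-cong (- (P - y + 1ℚ)) (y - (N - P)) ((N - P) + P - y - y + 1ℚ)
    (E≡eberlein j y (N + 1ℚ) (P + 1ℚ) ([N+1]-[P+1] N P))
    (E≡eberlein j (y + 1ℚ) (N + 1ℚ) (P + 1ℚ) ([N+1]-[P+1] N P)) refl
    (EberleinShiftP.relation y P (N - P) j)

eberlein-shiftQ : ∀ j y N Q {y₋ N₊ Q₊} → y₋ ≡ y - 1ℚ → N₊ ≡ N + 1ℚ → Q₊ ≡ Q + 1ℚ →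
  (- (((N - Q) + Q - y + 1ℚ + 1ℚ) * (Q + 1ℚ - y))) * E j y N Q
    + (y * (y - (N - Q) - 1ℚ)) * E j y₋ N Q
    + (((N - Q) + Q - y - y + 1ℚ + 1ℚ) * (Q + 1ℚ - ⟦ j ⟧)) * E j y N₊ Q₊ ≡ 0ℚ
eberlein-shiftQ j y N Q refl refl refl =
  three-term-cong (- (((N - Q) + Q - y + 1ℚ + 1ℚ) * (Q + 1ℚ - y))) (y * (y - (N - Q) - 1ℚ))
    (((N - Q) + Q - y - y + 1ℚ + 1ℚ) * (Q + 1ℚ - ⟦ j ⟧))
    refl refl (E≡eberlein j y (N + 1ℚ) (Q + 1ℚ) ([N+1]-[P+1] N Q))
    (EberleinShiftQ.relation y Q (N - Q) j)

linear-combination₃ : ∀ {A B C lhs rhs : ℚ} → A ≡ 0ℚ → B ≡ 0ℚ → C ≡ 0ℚ →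
  ∀ a b c → lhs - rhs ≡ a * A + b * B + c * C → lhs ≡ rhs
linear-combination₃ {lhs = lhs} {rhs} refl refl refl a b c eq =
  x-y≡0⇒x≡y lhs rhs (trans eq (vanish a b c))
  where
  vanish : ∀ a b c → a * 0ℚ + b * 0ℚ + c * 0ℚ ≡ 0ℚ
  vanish = solve-∀ ℚ-ring

*-cancelʳ : ∀ {a b} q → q ≢ 0ℚ → a * q ≡ b * q → a ≡ b
*-cancelʳ {a} {b} q q≢0 aq≡bq = begin
  a                ≡⟨ *-identityʳ a ⟨
  a * 1ℚ           ≡⟨ cong (a *_) (*-inverseʳ q) ⟨
  a * (q * 1/ q)   ≡⟨ *-assoc a q _ ⟨
  a * q * 1/ q     ≡⟨ cong (_* 1/ q) aq≡bq ⟩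
  b * q * 1/ q     ≡⟨ *-assoc b q _ ⟩
  b * (q * 1/ q)   ≡⟨ cong (b *_) (*-inverseʳ q) ⟩
  b * 1ℚ           ≡⟨ *-identityʳ b ⟩
  b                ∎
  where
  open ≡-Reasoning
  instance _ = ≢-nonZero q≢0

*-≢0 : ∀ {a b} → a ≢ 0ℚ → b ≢ 0ℚ → a * b ≢ 0ℚ
*-≢0 {a} {b} a≢0 b≢0 ab≡0 = a≢0 (*-cancelʳ b b≢0 (trans ab≡0 (sym (*-zeroˡ b))))

div-*-cancel : ∀ a q (q≢0 : q ≢ 0ℚ) → div a q q≢0 * q ≡ a
div-*-cancel a q q≢0 = trans (*-assoc a _ q) (trans (cong (a *_) (*-inverseˡ q)) (*-identityʳ a))
  where instance _ = ≢-nonZero q≢0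

inv-r-1*[r-1] : ∀ r (hr : 3 ≤ r) → inv-r-1 r hr * (⟦ r ⟧ - 1ℚ) ≡ 1ℚ
inv-r-1*[r-1] (suc zero)          (s≤s ())
inv-r-1*[r-1] (suc (suc zero))    (s≤s (s≤s ()))
inv-r-1*[r-1] (suc (suc (suc r))) _ =
  trans (cong (+ 1 / suc (suc r) *_) (trans (cong (_- 1ℚ) (⟦⟧-suc (suc (suc r)))) (+1-1 _)))
        (1/suc*suc (suc r))
  where
  +1-1 : ∀ a → a + 1ℚ - 1ℚ ≡ a
  +1-1 = solve-∀ ℚ-ring

-- The recurrence in y

-- The multipliers in the proof eliminate f₀ and f₊, the values at P + 1.
y-recurrence-cleared : ∀ J x y k n e₀ e₊ e₋ f₀ f₊ {d₁ d₂ d₃} →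
  let N = n - x ; P = k - x in
  (- (P - y + 1ℚ)) * f₀ + (y - (N - P)) * f₊ + ((N - P) + P - y - y + 1ℚ) * e₀ ≡ 0ℚ →
  (- (((N - P) + P - y + 1ℚ + 1ℚ) * (P + 1ℚ - y))) * e₀ + (y * (y - (N - P) - 1ℚ)) * e₋
    + (((N - P) + P - y - y + 1ℚ + 1ℚ) * (P + 1ℚ - J)) * f₀ ≡ 0ℚ →
  (- (((N - P) + P - (y + 1ℚ) + 1ℚ + 1ℚ) * (P + 1ℚ - (y + 1ℚ)))) * e₊
    + ((y + 1ℚ) * ((y + 1ℚ) - (N - P) - 1ℚ)) * e₀
    + (((N - P) + P - (y + 1ℚ) - (y + 1ℚ) + 1ℚ + 1ℚ) * (P + 1ℚ - J)) * f₊ ≡ 0ℚ →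
  d₁ ≡ ⟦ 2 ⟧ * y + x - n → d₂ ≡ ⟦ 2 ⟧ * y + x - n - 1ℚ → d₃ ≡ ⟦ 2 ⟧ * y + x - n - ⟦ 2 ⟧ →
  J * d₁ * d₂ * d₃ * e₀ ≡ (y + x - k) * (y + x - n - 1ℚ) * (y + k - n) * d₃ * (e₊ - e₀)
                          - y * (y + x - k - 1ℚ) * (y + k - n - 1ℚ) * d₁ * (e₋ - e₀)
y-recurrence-cleared J x y k n e₀ e₊ e₋ f₀ f₊ shiftP shiftQ shiftQ₊ refl refl refl =
  linear-combination₃ shiftP shiftQ shiftQ₊
    ((k - x + 1ℚ - J) * (n - x - y - y + ⟦ 2 ⟧) * (n - x - y - y))
    ((k - x - y + 1ℚ) * (n - x - y - y))
    (- ((y - (n - k)) * (n - x - y - y + ⟦ 2 ⟧)))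
    (solve (J ∷ x ∷ y ∷ k ∷ n ∷ e₀ ∷ e₊ ∷ e₋ ∷ f₀ ∷ f₊ ∷ []) ℚ-ring)

y-recurrence-divide : ∀ j e₀ e₊ e₋ B D {bn dn d₁ d₂ d₃} → d₁ ≢ 0ℚ → d₂ ≢ 0ℚ → d₃ ≢ 0ℚ →
  B * d₂ * d₁ ≡ bn → D * d₃ * d₂ ≡ dn →
  j * d₁ * d₂ * d₃ * e₀ ≡ bn * d₃ * (e₊ - e₀) - dn * d₁ * (e₋ - e₀) →
  j * e₀ ≡ B * e₊ - (B + - D) * e₀ + (- D) * e₋
y-recurrence-divide j e₀ e₊ e₋ B D {d₁ = d₁} {d₂} {d₃} h₁ h₂ h₃ refl refl cleared =
  *-cancelʳ (d₁ * d₂ * d₃) (*-≢0 (*-≢0 h₁ h₂) h₃) (begin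
    j * e₀ * (d₁ * d₂ * d₃)
      ≡⟨ solve (j ∷ e₀ ∷ d₁ ∷ d₂ ∷ d₃ ∷ []) ℚ-ring ⟩
    j * d₁ * d₂ * d₃ * e₀
      ≡⟨ cleared ⟩
    B * d₂ * d₁ * d₃ * (e₊ - e₀) - D * d₃ * d₂ * d₁ * (e₋ - e₀)
      ≡⟨ solve (e₀ ∷ e₊ ∷ e₋ ∷ d₁ ∷ d₂ ∷ d₃ ∷ B ∷ D ∷ []) ℚ-ring ⟩
    (B * e₊ - (B + - D) * e₀ + (- D) * e₋) * (d₁ * d₂ * d₃) ∎)
  where open ≡-Reasoning

three-term-scale : ∀ j e₀ e₊ e₋ B D c → j * e₀ ≡ B * e₊ - (B + D) * e₀ + D * e₋ →
  j * (c * e₀) ≡ B * (c * e₊) - (B + D) * (c * e₀) + D * (c * e₋)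
three-term-scale j e₀ e₊ e₋ B D c recurrence = begin
  j * (c * e₀)                                        ≡⟨ solve (j ∷ c ∷ e₀ ∷ []) ℚ-ring ⟩
  c * (j * e₀)                                        ≡⟨ cong (c *_) recurrence ⟩
  c * (B * e₊ - (B + D) * e₀ + D * e₋)                ≡⟨ solve (c ∷ e₀ ∷ e₊ ∷ e₋ ∷ B ∷ D ∷ []) ℚ-ring ⟩
  B * (c * e₊) - (B + D) * (c * e₀) + D * (c * e₋)    ∎
  where open ≡-Reasoning

⟦2y+x⟧ : ∀ y x → ⟦ 2 ℕ.* y ℕ.+ x ⟧ ≡ ⟦ 2 ⟧ * ⟦ y ⟧ + ⟦ x ⟧
⟦2y+x⟧ y x = trans (⟦⟧-+ (2 ℕ.* y) x) (cong (_+ ⟦ x ⟧) (⟦⟧-* 2 y))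

div-div-* : ∀ a {q₁ q₂} (h₁ : q₁ ≢ 0ℚ) (h₂ : q₂ ≢ 0ℚ) → div (div a q₁ h₁) q₂ h₂ * q₂ * q₁ ≡ a
div-div-* a {q₁} {q₂} h₁ h₂ = trans (cong (_* q₁) (div-*-cancel (div a q₁ h₁) q₂ h₂)) (div-*-cancel a q₁ h₁)

pEig-y-recurrence : ∀ r k n i j x y (h1 : den1 n x y ≢ 0ℚ) (h2 : den2 n x y ≢ 0ℚ) (h3 : den3 n x y ≢ 0ℚ) →
  let p = pEig r k n i j ; X = ⟦ x ⟧ ; Y = ⟦ y ⟧ ; B = Bco k n x y h1 h2 ; D = Dco k n x y h2 h3 in
  ⟦ j ⟧ * p X Y ≡ B * p X (Y + 1ℚ) - (B + D) * p X Y + D * p X (Y - 1ℚ)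
pEig-y-recurrence r k n i j x y h1 h2 h3 =
  three-term-scale ⟦ j ⟧ e₀ e₊ e₋ B (- D) (((⟦ r ⟧ - 1ℚ) ^ℚ j) * K i X (⟦ k ⟧ - ⟦ j ⟧) (⟦ r ⟧ - 1ℚ))
    (y-recurrence-divide ⟦ j ⟧ e₀ e₊ e₋ B D h1 h2 h3 (div-div-* bn h1 h2) (div-div-* dn h2 h3)
      (y-recurrence-cleared ⟦ j ⟧ X Y ⟦ k ⟧ ⟦ n ⟧ e₀ e₊ e₋ f₀ f₊
        (eberlein-shiftP j Y N P refl refl)
        (eberlein-shiftQ j Y N P refl refl refl)
        (eberlein-shiftQ j (Y + 1ℚ) N P (y+1-1 Y) refl refl)
        (cong (_- ⟦ n ⟧) (⟦2y+x⟧ y x))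
        (cong (λ z → z - ⟦ n ⟧ - 1ℚ) (⟦2y+x⟧ y x))
        (cong (λ z → z - ⟦ n ⟧ - ⟦ 2 ⟧) (⟦2y+x⟧ y x))))
  where
  X = ⟦ x ⟧
  Y = ⟦ y ⟧
  N = ⟦ n ⟧ - X
  P = ⟦ k ⟧ - X
  e₀ = E j Y N P
  e₊ = E j (Y + 1ℚ) N P
  e₋ = E j (Y - 1ℚ) N P
  f₀ = E j Y (N + 1ℚ) (P + 1ℚ)
  f₊ = E j (Y + 1ℚ) (N + 1ℚ) (P + 1ℚ)
  bn = (Y + X - ⟦ k ⟧) * (Y + X - ⟦ n ⟧ - 1ℚ) * (Y + ⟦ k ⟧ - ⟦ n ⟧)
  dn = Y * (Y + X - ⟦ k ⟧ - 1ℚ) * (Y + ⟦ k ⟧ - ⟦ n ⟧ - 1ℚ)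
  B = div (div bn (den1 n x y) h1) (den2 n x y) h2
  D = div (div dn (den2 n x y) h2) (den3 n x y) h3
  y+1-1 : ∀ y → y ≡ (y + 1ℚ) - 1ℚ
  y+1-1 = solve-∀ ℚ-ring

-- The recurrence in x

x-recurrence-cleared : ∀ i j x y k n r c K₀ K₊ K₋ e₀ e₁ e₂ e₃ e₄ {q} →
  let N = n - x ; P = k - x ; N₁ = n - (x + 1ℚ) ; Q₁ = k - (x + 1ℚ) ; p₀ = c * K₀ * e₀ in
  q ≡ n - x - ⟦ 2 ⟧ * y + 1ℚ →
  (- (((N₁ - Q₁) + Q₁ - y + 1ℚ + 1ℚ) * (Q₁ + 1ℚ - y))) * e₁ + (y * (y - (N₁ - Q₁) - 1ℚ)) * e₂
    + (((N₁ - Q₁) + Q₁ - y - y + 1ℚ + 1ℚ) * (Q₁ + 1ℚ - j)) * e₀ ≡ 0ℚ →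
  (- (P - y + 1ℚ)) * e₃ + (y - (N - P)) * e₄ + ((N - P) + P - y - y + 1ℚ) * e₀ ≡ 0ℚ →
  (((r - 1ℚ) - 1ℚ) * ((k - j) - x)) * K₊ + (- (((r - 1ℚ) - 1ℚ) * ((k - j) - x) + x - (r - 1ℚ) * i)) * K₀
    + x * K₋ ≡ 0ℚ →
  i * p₀ * q * (r - 1ℚ)
    + (r - ⟦ 2 ⟧) * (n - x - y + 1ℚ) * (k - x - y) * (c * K₊ * e₁ - p₀)
    - y * (r - ⟦ 2 ⟧) * (y + k - n - 1ℚ) * (c * K₊ * e₂ - p₀)
    + (k - x + 1ℚ - y) * x * (c * K₋ * e₃ - p₀)
    - x * (y + k - n) * (c * K₋ * e₄ - p₀)
    + (r - ⟦ 2 ⟧) * q * (j * p₀) ≡ 0ℚ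
x-recurrence-cleared i j x y k n r c K₀ K₊ K₋ e₀ e₁ e₂ e₃ e₄ refl shiftQ shiftP krawtchouk =
  linear-combination₃ shiftQ shiftP krawtchouk
    (- (c * (r - ⟦ 2 ⟧) * K₊)) (- (c * x * K₋)) (c * (n - x - ⟦ 2 ⟧ * y + 1ℚ) * e₀)
    (solve (i ∷ j ∷ x ∷ y ∷ k ∷ n ∷ r ∷ c ∷ K₀ ∷ K₊ ∷ K₋ ∷ e₀ ∷ e₁ ∷ e₂ ∷ e₃ ∷ e₄ ∷ []) ℚ-ring)

x-recurrence-divide : ∀ i j r ρ q p₀ p₁ p₂ p₃ p₄ p₊ p₋ B D v₁ v₂ v₃ v₄ {n₁ n₂ n₃ n₄} →
  v₁ * q ≡ n₁ → v₂ * q ≡ n₂ → v₃ * q ≡ n₃ → v₄ * q ≡ n₄ → ρ * (r - 1ℚ) ≡ 1ℚ → q ≢ 0ℚ →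
  j * p₀ ≡ B * p₊ - (B + D) * p₀ + D * p₋ →
  i * p₀ * q * (r - 1ℚ) + n₁ * (p₁ - p₀) - n₂ * (p₂ - p₀) + n₃ * (p₃ - p₀) - n₄ * (p₄ - p₀)
    + (r - ⟦ 2 ⟧) * q * (j * p₀) ≡ 0ℚ →
  let P₁ = - v₁ * ρ ; P₂ = v₂ * ρ ; P₃ = - v₃ * ρ ; P₄ = v₄ * ρ
      P₅ = - ((r - ⟦ 2 ⟧) * ρ) * D ; P₆ = - ((r - ⟦ 2 ⟧) * ρ) * B
  in i * p₀ ≡ P₁ * p₁ + P₂ * p₂ + P₃ * p₃ + P₄ * p₄ + P₅ * p₋ + P₆ * p₊
              + (- P₁ - P₂ - P₃ - P₄ - P₅ - P₆) * p₀
x-recurrence-divide i j r ρ q p₀ p₁ p₂ p₃ p₄ p₊ p₋ B D v₁ v₂ v₃ v₄ refl refl refl refl ρ[r-1]≡1 q≢0 y-recurrence cleared =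
  x-y≡0⇒x≡y _ _ (*-cancelʳ (q * (r - 1ℚ)) (*-≢0 q≢0 r-1≢0) (begin
    (i * p₀ - ((- v₁ * ρ) * p₁ + (v₂ * ρ) * p₂ + (- v₃ * ρ) * p₃ + (v₄ * ρ) * p₄
               + (- ((r - ⟦ 2 ⟧) * ρ) * D) * p₋ + (- ((r - ⟦ 2 ⟧) * ρ) * B) * p₊
               + (- (- v₁ * ρ) - v₂ * ρ - (- v₃ * ρ) - v₄ * ρ - (- ((r - ⟦ 2 ⟧) * ρ) * D)
                  - (- ((r - ⟦ 2 ⟧) * ρ) * B)) * p₀)) * (q * (r - 1ℚ))
      ≡⟨ solve (i ∷ j ∷ r ∷ ρ ∷ q ∷ p₀ ∷ p₁ ∷ p₂ ∷ p₃ ∷ p₄ ∷ p₊ ∷ p₋ ∷ B ∷ D ∷ v₁ ∷ v₂ ∷ v₃ ∷ v₄ ∷ []) ℚ-ring ⟩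
    i * p₀ * q * (r - 1ℚ) + v₁ * q * (ρ * (r - 1ℚ)) * (p₁ - p₀) - v₂ * q * (ρ * (r - 1ℚ)) * (p₂ - p₀)
      + v₃ * q * (ρ * (r - 1ℚ)) * (p₃ - p₀) - v₄ * q * (ρ * (r - 1ℚ)) * (p₄ - p₀)
      + (r - ⟦ 2 ⟧) * q * (ρ * (r - 1ℚ)) * (B * p₊ - (B + D) * p₀ + D * p₋)
      ≡⟨ cong₂ (λ u t → i * p₀ * q * (r - 1ℚ) + v₁ * q * u * (p₁ - p₀) - v₂ * q * u * (p₂ - p₀)
                          + v₃ * q * u * (p₃ - p₀) - v₄ * q * u * (p₄ - p₀) + (r - ⟦ 2 ⟧) * q * u * t)
               ρ[r-1]≡1 (sym y-recurrence) ⟩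
    i * p₀ * q * (r - 1ℚ) + v₁ * q * 1ℚ * (p₁ - p₀) - v₂ * q * 1ℚ * (p₂ - p₀)
      + v₃ * q * 1ℚ * (p₃ - p₀) - v₄ * q * 1ℚ * (p₄ - p₀) + (r - ⟦ 2 ⟧) * q * 1ℚ * (j * p₀)
      ≡⟨ solve (i ∷ j ∷ r ∷ q ∷ p₀ ∷ p₁ ∷ p₂ ∷ p₃ ∷ p₄ ∷ v₁ ∷ v₂ ∷ v₃ ∷ v₄ ∷ []) ℚ-ring ⟩
    i * p₀ * q * (r - 1ℚ) + v₁ * q * (p₁ - p₀) - v₂ * q * (p₂ - p₀) + v₃ * q * (p₃ - p₀)
      - v₄ * q * (p₄ - p₀) + (r - ⟦ 2 ⟧) * q * (j * p₀)
      ≡⟨ cleared ⟩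
    0ℚ
      ≡⟨ *-zeroˡ (q * (r - 1ℚ)) ⟨
    0ℚ * (q * (r - 1ℚ)) ∎))
  where
  open ≡-Reasoning
  r-1≢0 : r - 1ℚ ≢ 0ℚ
  r-1≢0 r-1≡0 = 1≢0 (trans (sym ρ[r-1]≡1) (trans (cong (ρ *_) r-1≡0) (*-zeroʳ ρ)))

shift-down : ∀ a x → a - x ≡ (a - (x + 1ℚ)) + 1ℚ
shift-down = solve-∀ ℚ-ring

shift-up : ∀ a x → a - (x - 1ℚ) ≡ (a - x) + 1ℚ
shift-up = solve-∀ ℚ-ring

pEig-x-recurrence : ∀ r k n (hr : 3 ≤ r) i j x y (h1 : den1 n x y ≢ 0ℚ) (h2 : den2 n x y ≢ 0ℚ)
  (h3 : den3 n x y ≢ 0ℚ) (h4 : den4 n x y ≢ 0ℚ) →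
  let p = pEig r k n i j ; X = ⟦ x ⟧ ; Y = ⟦ y ⟧ ; B = Bco k n x y h1 h2 ; D = Dco k n x y h2 h3
      ρ = inv-r-1 r hr ; q = den4 n x y ; c = ⟦ r ⟧ - ⟦ 2 ⟧
      P1 = - div (c * (⟦ n ⟧ - X - Y + 1ℚ) * (⟦ k ⟧ - X - Y)) q h4 * ρ
      P2 = div (Y * c * (Y + ⟦ k ⟧ - ⟦ n ⟧ - 1ℚ)) q h4 * ρ
      P3 = - div ((⟦ k ⟧ - X + 1ℚ - Y) * X) q h4 * ρ
      P4 = div (X * (Y + ⟦ k ⟧ - ⟦ n ⟧)) q h4 * ρ
      P5 = - (c * ρ) * D
      P6 = - (c * ρ) * B
      P7 = - P1 - P2 - P3 - P4 - P5 - P6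
  in ⟦ i ⟧ * p X Y ≡
       P1 * p (X + 1ℚ) Y + P2 * p (X + 1ℚ) (Y - 1ℚ) + P3 * p (X - 1ℚ) Y
       + P4 * p (X - 1ℚ) (Y + 1ℚ) + P5 * p X (Y - 1ℚ) + P6 * p X (Y + 1ℚ) + P7 * p X Y
pEig-x-recurrence r k n hr i j x y h1 h2 h3 h4 =
  x-recurrence-divide ⟦ i ⟧ ⟦ j ⟧ ⟦ r ⟧ (inv-r-1 r hr) q (p X Y) (p (X + 1ℚ) Y) (p (X + 1ℚ) (Y - 1ℚ))
    (p (X - 1ℚ) Y) (p (X - 1ℚ) (Y + 1ℚ)) (p X (Y + 1ℚ)) (p X (Y - 1ℚ))
    (Bco k n x y h1 h2) (Dco k n x y h2 h3) (div n₁ q h4) (div n₂ q h4) (div n₃ q h4) (div n₄ q h4)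
    (div-*-cancel n₁ q h4) (div-*-cancel n₂ q h4) (div-*-cancel n₃ q h4) (div-*-cancel n₄ q h4)
    (inv-r-1*[r-1] r hr) h4
    (pEig-y-recurrence r k n i j x y h1 h2 h3)
    (x-recurrence-cleared ⟦ i ⟧ ⟦ j ⟧ X Y ⟦ k ⟧ ⟦ n ⟧ ⟦ r ⟧ ((⟦ r ⟧ - 1ℚ) ^ℚ j)
       (κ X) (κ (X + 1ℚ)) (κ (X - 1ℚ))
       (e X Y) (e (X + 1ℚ) Y) (e (X + 1ℚ) (Y - 1ℚ)) (e (X - 1ℚ) Y) (e (X - 1ℚ) (Y + 1ℚ))
       (cong (λ z → ⟦ n ⟧ - X - z + 1ℚ) (⟦⟧-* 2 y))
       (eberlein-shiftQ j Y (⟦ n ⟧ - (X + 1ℚ)) (⟦ k ⟧ - (X + 1ℚ)) refl (shift-down ⟦ n ⟧ X) (shift-down ⟦ k ⟧ X))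
       (eberlein-shiftP j Y (⟦ n ⟧ - X) (⟦ k ⟧ - X) (shift-up ⟦ n ⟧ X) (shift-up ⟦ k ⟧ X))
       (KrawtchoukRecurrence.relation X (⟦ k ⟧ - ⟦ j ⟧) (⟦ r ⟧ - 1ℚ) i))
  where
  p = pEig r k n i j
  X = ⟦ x ⟧
  Y = ⟦ y ⟧
  q = den4 n x y
  c = ⟦ r ⟧ - ⟦ 2 ⟧
  κ : ℚ → ℚ
  κ x′ = K i x′ (⟦ k ⟧ - ⟦ j ⟧) (⟦ r ⟧ - 1ℚ)
  e : ℚ → ℚ → ℚ
  e x′ y′ = E j y′ (⟦ n ⟧ - x′) (⟦ k ⟧ - x′)
  n₁ = c * (⟦ n ⟧ - X - Y + 1ℚ) * (⟦ k ⟧ - X - Y)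
  n₂ = Y * c * (Y + ⟦ k ⟧ - ⟦ n ⟧ - 1ℚ)
  n₃ = (⟦ k ⟧ - X + 1ℚ - Y) * X
  n₄ = X * (Y + ⟦ k ⟧ - ⟦ n ⟧)

mainTheorem4 : (r k n : ℕ) → (hr : 3 ≤ r) → 1 ≤ k → k < n →
    (i j x y : ℕ) → InD k n i j → InD k n x y →
    (h1 : den1 n x y ≢ 0ℚ) → (h2 : den2 n x y ≢ 0ℚ) → (h3 : den3 n x y ≢ 0ℚ) →
    let p : ℚ → ℚ → ℚ
        p = pEig r k n i j
        X = ⟦ x ⟧
        Y = ⟦ y ⟧
        B = Bco k n x y h1 h2
        D = Dco k n x y h2 h3
        ρ = inv-r-1 r hr
    in (⟦ j ⟧ * p X Y ≡ B * p X (Y + 1ℚ) - (B + D) * p X Y + D * p X (Y - 1ℚ))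
       × ((h4 : den4 n x y ≢ 0ℚ) →
          let q = den4 n x y
              c = ⟦ r ⟧ - ⟦ 2 ⟧
              P1 = - div (c * (⟦ n ⟧ - X - Y + 1ℚ) * (⟦ k ⟧ - X - Y)) q h4 * ρ
              P2 = div (Y * c * (Y + ⟦ k ⟧ - ⟦ n ⟧ - 1ℚ)) q h4 * ρ
              P3 = - div ((⟦ k ⟧ - X + 1ℚ - Y) * X) q h4 * ρ
              P4 = div (X * (Y + ⟦ k ⟧ - ⟦ n ⟧)) q h4 * ρ
              P5 = - (c * ρ) * D
              P6 = - (c * ρ) * B
              P7 = - P1 - P2 - P3 - P4 - P5 - P6
          in ⟦ i ⟧ * p X Y ≡
               P1 * p (X + 1ℚ) Y + P2 * p (X + 1ℚ) (Y - 1ℚ) + P3 * p (X - 1ℚ) Y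
               + P4 * p (X - 1ℚ) (Y + 1ℚ) + P5 * p X (Y - 1ℚ) + P6 * p X (Y + 1ℚ)
               + P7 * p X Y)
mainTheorem4 r k n hr _ _ i j x y _ _ h1 h2 h3 =
  pEig-y-recurrence r k n i j x y h1 h2 h3 , pEig-x-recurrence r k n hr i j x y h1 h2 h3
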